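{- Let $m>n$, $\pi\in\mathfrak{S}_n$, and $\pi'=(\pi_1,\dots,\pi_n,n+1,n+2,\dots,m)\in\mathfrak{S}_m$. Then $|\mathcal{O}_{\mathrm{MVP}_m}^{ -1}(\pi')| = |\mathcal{O}_{\mathrm{MVP}_n}^{ -1}(\pi)|$.
   Context: For any $N$: spots $1,\dots,N$ on a one-way street; cars $1,\dots,N$ arrive in order with preferences $\alpha=(a_1,\dots,a_N)\in[N]^N$. MVP parking rule: when car $i$ arrives, if spot $a_i$ is unoccupied, car $i$ parks there; if spot $a_i$ is occupied by an earlier car $j$, then car $i$ parks in spot $a_i$ and car $j$ is bumped and parks in the first unoccupied spot among $a_i+1,\dots,N$, if any (otherwise car $j$ fails to park); a bumped car never bumps another car. $\alpha$ is an MVP parking function of length $N$ if all cars park; its outcome $\mathcal{O}_{\mathrm{MVP}_N}(\alpha)$ is the permutation (in one-line notation) whose $j$th entry is the car parked in spot $j$; $\mathcal{O}_{\mathrm{MVP}_N}^{ -1}(\pi)$ is the set of MVP parking functions of length $N$ with outcome $\pi$. -}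

module Defs where

open import Data.Nat using (ℕ; zero; suc; _<_; _<ᵇ_; _≤_)
open import Data.Nat.Properties using (<-≤-trans)
open import Data.Fin using (Fin; toℕ; inject≤; fromℕ<)
open import Data.Fin.Permutation using (Permutation′; _⟨$⟩ʳ_)
open import Data.Bool using (Bool; true; false; _∧_)
open import Data.Maybe using (Maybe; just; nothing; _>>=_; is-nothing)
open import Data.List using (List; []; _∷_; allFin; filter; length; zip; foldl)
open import Data.Vec using (Vec; []; _∷_; lookup; _[_]≔_; replicate; tabulate; toList)
open import Data.Product using (_×_; _,_)
open import Relation.Nullary using (Dec; yes; no)
open import Relation.Nullary.Decidable using (⌊_⌋)
import Data.Fin.Properties as FinP
import Data.Vec.Properties as VecP
import Data.Maybe.Properties as MaybeP
import Data.List as L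

-- Cars and spots are both indexed by Fin N (0-based: car i ↦ car i+1,
-- spot j ↦ spot j+1).  A street state assigns to every spot the car
-- parked there, if any.
State : ℕ → Set
State N = Vec (Maybe (Fin N)) N

firstFreeAfter : {N : ℕ} → State N → Fin N → Maybe (Fin N)
firstFreeAfter {N} s a = L.head (filter (λ k → Data.Bool.T? ((toℕ a <ᵇ toℕ k) ∧ is-nothing (lookup s k))) (allFin N))
  where import Data.Bool

mvpStep : {N : ℕ} → Maybe (State N) → Fin N × Fin N → Maybe (State N)
mvpStep nothing _ = nothing
mvpStep (just s) (i , a) with lookup s a
... | nothing = just (s [ a ]≔ just i)
... | just j with firstFreeAfter s a
...   | nothing = nothing
...   | just k = just ((s [ a ]≔ just i) [ k ]≔ just j)

allJust : {A : Set} {N : ℕ} → Vec (Maybe A) N → Maybe (Vec A N)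
allJust [] = just []
allJust (nothing ∷ _) = nothing
allJust (just x ∷ xs) = allJust xs >>= λ ys → just (x ∷ ys)

-- Result: nothing if some car fails to park (α not an MVP parking function),
-- otherwise just the outcome O_MVP_N(α) in one-line notation (entry j =
-- car in spot j).
mvpOutcome : {N : ℕ} → Vec (Fin N) N → Maybe (Vec (Fin N) N)
mvpOutcome {N} α =
  foldl mvpStep (just (replicate N nothing)) (zip (allFin N) (toList α)) >>= allJust

allVecs : (N k : ℕ) → List (Vec (Fin N) k)
allVecs N zero = [] ∷ []
allVecs N (suc k) = L.concatMap (λ x → L.map (x ∷_) (allVecs N k)) (allFin N)

fiberSize : (N : ℕ) → Vec (Fin N) N → ℕ
fiberSize N π =
  length (filter (λ α → MaybeP.≡-dec (VecP.≡-dec FinP._≟_) (mvpOutcome α) (just π)) (allVecs N N))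

oneLine : {n : ℕ} → Permutation′ n → Vec (Fin n) n
oneLine π = tabulate (π ⟨$⟩ʳ_)

extendOneLine : {n m : ℕ} → n ≤ m → Permutation′ n → Vec (Fin m) m
extendOneLine {n} {m} n≤m π = tabulate f
  where
  f : Fin m → Fin m
  f j with toℕ j Data.Nat.<? n
  ... | yes j<n = inject≤ (π ⟨$⟩ʳ fromℕ< j<n) n≤m
  ... | no _ = j

-- Append car N+1 with preference N+1 to an MVP parking function α of length N:
-- the first N cars run exactly as before with spot N+1 left free, and then car
-- N+1 parks there, so the outcome gains the fixed point N+1.  Conversely, if
-- the outcome ends in N+1, the last car (which is never bumped) must have
-- preferred spot N+1, and no earlier car can have: the first one that did would
-- leave spot N+1 to one of the first N cars, who can then only be bumped into
-- failure.  Hence α ↦ α ++ (N+1) is a bijection between the fibres, and the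
-- theorem follows by induction on m − n.
module Submission where

open import Defs
open import Data.Bool using (Bool; true; false; T; T?; _∧_)
open import Data.Bool.Properties using (T-∧)
open import Data.Empty using (⊥-elim)
open import Data.Fin using (Fin; zero; suc; toℕ; fromℕ; fromℕ<; inject₁; inject≤)
import Data.Fin.Properties as Finₚ
open import Data.Fin.Permutation using (Permutation′; _⟨$⟩ʳ_)
open import Data.List as List
  using (List; []; _∷_; _++_; [_]; length; filter; allFin; zip; foldl; head; cartesianProductWith)
import Data.List.Properties as Listₚ
open import Data.List.Membership.Propositional using (_∈_)
open import Data.List.Membership.Propositional.Properties
  using (∈-filter⁺; ∈-filter⁻; ∈-map⁺; ∈-map⁻; ∈-allFin; ∈-cartesianProductWith⁺)
open import Data.List.Membership.Propositional.Properties.WithK using (unique∧set⇒bag)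
open import Data.List.Relation.Binary.BagAndSetEquality using (∼bag⇒↭)
open import Data.List.Relation.Binary.Permutation.Propositional.Properties using (↭-length)
import Data.List.Relation.Unary.All as All
import Data.List.Relation.Unary.AllPairs as AllPairs
open import Data.List.Relation.Unary.Any using (here; there)
open import Data.List.Relation.Unary.Unique.Propositional using (Unique)
import Data.List.Relation.Unary.Unique.Propositional.Properties as Uniqueₚ
open import Data.Maybe as Maybe using (Maybe; just; nothing; _>>=_; _<∣>_; is-nothing)
import Data.Maybe.Properties as Maybeₚ
open import Data.Nat using (ℕ; zero; suc; _<_; _≤_; _<ᵇ_; _<?_; _≤′_; ≤′-refl; ≤′-step)
import Data.Nat.Properties as ℕₚ
open import Data.Product as Prod using (∃; _×_; _,_)
open import Data.Sum using (_⊎_; inj₁; inj₂)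
open import Data.Unit using (⊤; tt)
open import Data.Vec as Vec using (Vec; []; _∷_; _∷ʳ_; lookup; _[_]≔_; replicate; toList)
import Data.Vec.Properties as Vecₚ
open import Function using (_∘_; id; _∋_)
open import Function.Bundles using (mk⇔; Equivalence)
open import Function.Definitions using (Injective)
open import Relation.Binary.PropositionalEquality
  using (_≡_; _≢_; refl; sym; trans; cong; cong₂; subst; module ≡-Reasoning)
open import Relation.Nullary using (¬_; yes; no; does; contradiction)
open import Relation.Unary using (Pred; Decidable; _≐_)
open import Level using (0ℓ)

data InjectOrLast {N : ℕ} : Fin (suc N) → Set where
  injected : (j : Fin N) → InjectOrLast (inject₁ j)
  last     : InjectOrLast (fromℕ N)

injectOrLast : ∀ {N} (i : Fin (suc N)) → InjectOrLast i
injectOrLast {zero}  zero    = last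
injectOrLast {suc N} zero    = injected zero
injectOrLast {suc N} (suc i) with injectOrLast i
... | injected j = injected (suc j)
... | last       = last

module _ {A : Set} where

  ≡-by-lookup : ∀ {N} {xs ys : Vec A N} → (∀ i → lookup xs i ≡ lookup ys i) → xs ≡ ys
  ≡-by-lookup {xs = xs} {ys} eq =
    trans (sym (Vecₚ.tabulate∘lookup xs)) (trans (Vecₚ.tabulate-cong eq) (Vecₚ.tabulate∘lookup ys))

  lookup-∷ʳ-inject₁ : ∀ {N} (xs : Vec A N) x j → lookup (xs ∷ʳ x) (inject₁ j) ≡ lookup xs j
  lookup-∷ʳ-inject₁ (y ∷ xs) x zero    = refl
  lookup-∷ʳ-inject₁ (y ∷ xs) x (suc j) = lookup-∷ʳ-inject₁ xs x j

  lookup-∷ʳ-fromℕ : ∀ {N} (xs : Vec A N) x → lookup (xs ∷ʳ x) (fromℕ N) ≡ x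
  lookup-∷ʳ-fromℕ []       x = refl
  lookup-∷ʳ-fromℕ (y ∷ xs) x = lookup-∷ʳ-fromℕ xs x

  ∷ʳ-[inject₁]≔ : ∀ {N} (xs : Vec A N) x j y → (xs ∷ʳ x) [ inject₁ j ]≔ y ≡ (xs [ j ]≔ y) ∷ʳ x
  ∷ʳ-[inject₁]≔ (z ∷ xs) x zero    y = refl
  ∷ʳ-[inject₁]≔ (z ∷ xs) x (suc j) y = cong (z ∷_) (∷ʳ-[inject₁]≔ xs x j y)

  ∷ʳ-[fromℕ]≔ : ∀ {N} (xs : Vec A N) x y → (xs ∷ʳ x) [ fromℕ N ]≔ y ≡ xs ∷ʳ y
  ∷ʳ-[fromℕ]≔ []       x y = refl
  ∷ʳ-[fromℕ]≔ (z ∷ xs) x y = cong (z ∷_) (∷ʳ-[fromℕ]≔ xs x y)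

  replicate-∷ʳ : ∀ N (x : A) → replicate (suc N) x ≡ replicate N x ∷ʳ x
  replicate-∷ʳ zero    x = refl
  replicate-∷ʳ (suc N) x = cong (x ∷_) (replicate-∷ʳ N x)

  allJust-∷ʳ : ∀ {N} (xs : Vec (Maybe A) N) c → allJust (xs ∷ʳ just c) ≡ Maybe.map (_∷ʳ c) (allJust xs)
  allJust-∷ʳ []            c = refl
  allJust-∷ʳ (nothing ∷ xs) c = refl
  allJust-∷ʳ (just x ∷ xs) c rewrite allJust-∷ʳ xs c with allJust xs
  ... | nothing = refl
  ... | just ys = refl

  allJust-lookup : ∀ {N} (xs : Vec (Maybe A) N) {ys} → allJust xs ≡ just ys →
                   ∀ k → lookup xs k ≡ just (lookup ys k)
  allJust-lookup (nothing ∷ xs) () k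
  allJust-lookup (just x ∷ xs) eq k with allJust xs in eq′
  allJust-lookup (just x ∷ xs) () k       | nothing
  allJust-lookup (just x ∷ xs) refl zero    | just ys = refl
  allJust-lookup (just x ∷ xs) refl (suc k) | just ys = allJust-lookup xs eq′ k

allJust-map : ∀ {A B : Set} {N} (f : A → B) (xs : Vec (Maybe A) N) →
              allJust (Vec.map (Maybe.map f) xs) ≡ Maybe.map (Vec.map f) (allJust xs)
allJust-map f []             = refl
allJust-map f (nothing ∷ xs) = refl
allJust-map f (just x ∷ xs) rewrite allJust-map f xs with allJust xs
... | nothing = refl
... | just ys = refl

module _ {A : Set} where

  tabulate-∷ʳ : ∀ {N} (f : Fin (suc N) → A) →
                List.tabulate f ≡ List.tabulate (f ∘ inject₁) ++ [ f (fromℕ N) ]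
  tabulate-∷ʳ {zero}  f = refl
  tabulate-∷ʳ {suc N} f = cong (f zero ∷_) (tabulate-∷ʳ (f ∘ suc))

  head-++ : (xs ys : List A) → head (xs ++ ys) ≡ (head xs <∣> head ys)
  head-++ []       ys = refl
  head-++ (x ∷ xs) ys = refl

  head-filter-just : {P : Pred A 0ℓ} (P? : Decidable P) (xs : List A) {x : A} →
                     head (filter P? xs) ≡ just x → P x
  head-filter-just P? (y ∷ xs) eq with P? y
  ... | yes Py = subst _ (Maybeₚ.just-injective eq) Py
  ... | no  _  = head-filter-just P? xs eq

  filter-map : ∀ {B : Set} {P : Pred B 0ℓ} (P? : Decidable P) (f : A → B) (xs : List A) →
               filter P? (List.map f xs) ≡ List.map f (filter (P? ∘ f) xs)
  filter-map P? f []       = refl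
  filter-map P? f (x ∷ xs) with does (P? (f x))
  ... | true  = cong (f x ∷_) (filter-map P? f xs)
  ... | false = filter-map P? f xs

  zip-++ : ∀ {B : Set} (xs : List A) (ys : List B) {xs′ ys′} → length xs ≡ length ys →
           zip (xs ++ xs′) (ys ++ ys′) ≡ zip xs ys ++ zip xs′ ys′
  zip-++ []       []       _   = refl
  zip-++ (x ∷ xs) (y ∷ ys) len = cong ((x , y) ∷_) (zip-++ xs ys (ℕₚ.suc-injective len))

allFin-suc : ∀ N → allFin (suc N) ≡ List.map inject₁ (allFin N) ++ [ fromℕ N ]
allFin-suc N = trans (tabulate-∷ʳ id) (cong (_++ [ fromℕ N ]) (sym (Listₚ.map-tabulate id inject₁)))

concatMap≡cartesianProductWith : ∀ {A B C : Set} (f : A → B → C) (xs : List A) (ys : List B) →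
                List.concatMap (λ x → List.map (f x) ys) xs ≡ cartesianProductWith f xs ys
concatMap≡cartesianProductWith f []       ys = refl
concatMap≡cartesianProductWith f (x ∷ xs) ys =
  cong (List.map (f x) ys ++_) (concatMap≡cartesianProductWith f xs ys)

module _ {A B : Set} {P : Pred A 0ℓ} {Q : Pred B 0ℓ} (P? : Decidable P) (Q? : Decidable Q) where

  length-filter-image : ∀ {xs ys} (g : A → B) → Injective _≡_ _≡_ g →
    Unique xs → Unique ys → (∀ x → x ∈ xs) → (∀ y → y ∈ ys) →
    (∀ x → P x → Q (g x)) → (∀ x → Q (g x) → P x) → (∀ y → Q y → ∃ λ x → y ≡ g x) →
    length (filter Q? ys) ≡ length (filter P? xs)
  length-filter-image {xs} {ys} g g-inj xs! ys! ∈xs ∈ys forth back onto =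
    trans (↭-length (∼bag⇒↭ (unique∧set⇒bag (Uniqueₚ.filter⁺ Q? ys!) image! (mk⇔ ⊆image image⊆))))
          (Listₚ.length-map g (filter P? xs))
    where
    image! : Unique (List.map g (filter P? xs))
    image! = Uniqueₚ.map⁺ g-inj (Uniqueₚ.filter⁺ P? xs!)
    ⊆image : ∀ {y} → y ∈ filter Q? ys → y ∈ List.map g (filter P? xs)
    ⊆image {y} y∈ with ∈-filter⁻ Q? {xs = ys} y∈
    ... | _ , Qy with onto y Qy
    ...   | x , refl = ∈-map⁺ g (∈-filter⁺ P? (∈xs x) (back x Qy))
    image⊆ : ∀ {y} → y ∈ List.map g (filter P? xs) → y ∈ filter Q? ys
    image⊆ y∈ with ∈-map⁻ g y∈
    ... | x , x∈ , refl with ∈-filter⁻ P? {xs = xs} x∈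
    ...   | _ , Px = ∈-filter⁺ Q? (∈ys (g x)) (forth x Px)

allVecs-suc : ∀ N k → allVecs N (suc k) ≡ cartesianProductWith _∷_ (allFin N) (allVecs N k)
allVecs-suc N k = concatMap≡cartesianProductWith _∷_ (allFin N) (allVecs N k)

allVecs-unique : ∀ N k → Unique (allVecs N k)
allVecs-unique N zero    = All.[] AllPairs.∷ AllPairs.[]
allVecs-unique N (suc k) rewrite allVecs-suc N k =
  Uniqueₚ.cartesianProductWith⁺ _∷_ Vecₚ.∷-injective (Uniqueₚ.allFin⁺ N) (allVecs-unique N k)

∈-allVecs : ∀ N {k} (v : Vec (Fin N) k) → v ∈ allVecs N k
∈-allVecs N []      = here refl
∈-allVecs N {suc k} (x ∷ v) rewrite allVecs-suc N k =
  ∈-cartesianProductWith⁺ _∷_ (∈-allFin x) (∈-allVecs N v)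

isFreeAfter : ∀ {N} → State N → Fin N → Fin N → Bool
isFreeAfter s a k = (toℕ a <ᵇ toℕ k) ∧ is-nothing (lookup s k)

T-is-nothing : ∀ {A : Set} (m : Maybe A) → T (is-nothing m) → m ≡ nothing
T-is-nothing nothing _ = refl

firstFreeAfter-sound : ∀ {N} (s : State N) a {k} → firstFreeAfter s a ≡ just k →
                       toℕ a < toℕ k × lookup s k ≡ nothing
firstFreeAfter-sound {N} s a {k} eq =
  Prod.map (ℕₚ.<ᵇ⇒< (toℕ a) (toℕ k)) (T-is-nothing (lookup s k))
           (Equivalence.to T-∧ (head-filter-just _ (allFin N) eq))

firstFreeAfter-fromℕ : ∀ {N} (s : State (suc N)) → firstFreeAfter s (fromℕ N) ≡ nothing
firstFreeAfter-fromℕ {N} s with firstFreeAfter s (fromℕ N) in eq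
... | nothing = refl
... | just k  =
  contradiction (Finₚ.≤fromℕ k) (ℕₚ.<⇒≱ (Prod.proj₁ (firstFreeAfter-sound s (fromℕ N) eq)))

module _ {N : ℕ} {s : State N} {a : Fin N} (i : Fin N) where

  mvpStep-park : lookup s a ≡ nothing → mvpStep (just s) (i , a) ≡ just (s [ a ]≔ just i)
  mvpStep-park occupant rewrite occupant = refl

  mvpStep-bump : ∀ {j k} → lookup s a ≡ just j → firstFreeAfter s a ≡ just k →
                 mvpStep (just s) (i , a) ≡ just ((s [ a ]≔ just i) [ k ]≔ just j)
  mvpStep-bump occupant free rewrite occupant | free = refl

  mvpStep-fail : ∀ {j} → lookup s a ≡ just j → firstFreeAfter s a ≡ nothing →
                 mvpStep (just s) (i , a) ≡ nothing
  mvpStep-fail occupant free rewrite occupant | free = refl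

mvpStep-lookup : ∀ {N} (m : Maybe (State N)) i a {s′} →
                 mvpStep m (i , a) ≡ just s′ → lookup s′ a ≡ just i
mvpStep-lookup (just s) i a eq with lookup s a
mvpStep-lookup (just s) i a refl | nothing = Vecₚ.lookup∘update a s (just i)
mvpStep-lookup (just s) i a eq   | just j with firstFreeAfter s a in free
mvpStep-lookup (just s) i a refl | just j | just k =
  trans (Vecₚ.lookup∘update′ a≢k (s [ a ]≔ just i) (just j))
        (Vecₚ.lookup∘update a s (just i))
  where
  a≢k : a ≢ k
  a≢k = Finₚ.<⇒≢ (Prod.proj₁ (firstFreeAfter-sound s a free))

mvpStep-allJust-lookup : ∀ {N} (m : Maybe (State N)) i a {w} → (mvpStep m (i , a) >>= allJust) ≡ just w →
                         lookup w a ≡ i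
mvpStep-allJust-lookup m i a eq with mvpStep m (i , a) in step
... | just s′ = Maybeₚ.just-injective (trans (sym (allJust-lookup s′ eq a)) (mvpStep-lookup m i a step))

-- Blocked runs are those in which car N+1 can no longer end up in spot N+1:
-- the spot is held by an earlier car, which could only be bumped out of the street.
Blocked : ∀ {N} → Maybe (State (suc N)) → Set
Blocked nothing = ⊤
Blocked {N} (just s) = ∃ λ j → lookup s (fromℕ N) ≡ just (inject₁ j)

mvpStep-blocked : ∀ {N} {mb : Maybe (State (suc N))} → Blocked mb → ∀ q → Blocked (mvpStep mb q)
mvpStep-blocked {mb = nothing} _ q = tt
mvpStep-blocked {N} {just s} (j , held) (c , a) with lookup s a in occupant
... | nothing = j , trans (Vecₚ.lookup∘update′ last≢a s (just c)) held
  where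
  last≢a : fromℕ N ≢ a
  last≢a refl with trans (sym occupant) held
  ... | ()
... | just j′ with firstFreeAfter s a in free
...   | nothing = tt
...   | just k  = j , trans (Vecₚ.lookup∘update′ last≢k (s [ a ]≔ just c) (just j′))
                            (trans (Vecₚ.lookup∘update′ last≢a s (just c)) held)
  where
  a<k : toℕ a < toℕ k
  a<k = Prod.proj₁ (firstFreeAfter-sound s a free)
  last≢k : fromℕ N ≢ k
  last≢k refl with trans (sym (Prod.proj₂ (firstFreeAfter-sound s a free))) held
  ... | ()
  last≢a : fromℕ N ≢ a
  last≢a refl = ℕₚ.<⇒≱ a<k (Finₚ.≤fromℕ k)

foldl-blocked : ∀ {N} {mb : Maybe (State (suc N))} → Blocked mb → ∀ qs → Blocked (foldl mvpStep mb qs)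
foldl-blocked b []       = b
foldl-blocked b (q ∷ qs) = foldl-blocked (mvpStep-blocked b q) qs

mvpStep-prefers-last : ∀ {N} (mb : Maybe (State (suc N))) i → Blocked (mvpStep mb (inject₁ i , fromℕ N))
mvpStep-prefers-last nothing i = tt
mvpStep-prefers-last {N} (just s) i with lookup s (fromℕ N) in occupant
... | nothing = i , Vecₚ.lookup∘update (fromℕ N) s (just (inject₁ i))
... | just j rewrite firstFreeAfter-fromℕ s = tt

mvpStep-blocked-last : ∀ {N} {mb : Maybe (State (suc N))} → Blocked mb → ∀ c →
                       mvpStep mb (c , fromℕ N) ≡ nothing
mvpStep-blocked-last {mb = nothing} _ c = refl
mvpStep-blocked-last {mb = just s} (j , held) c = mvpStep-fail {s = s} c held (firstFreeAfter-fromℕ s)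

embed : ∀ {N} → State N → State (suc N)
embed s = Vec.map (Maybe.map inject₁) s ∷ʳ nothing

module _ {N : ℕ} (s : State N) where

  lookup-embed-inject₁ : ∀ {j o} → lookup s j ≡ o → lookup (embed s) (inject₁ j) ≡ Maybe.map inject₁ o
  lookup-embed-inject₁ {j} refl =
    trans (lookup-∷ʳ-inject₁ (Vec.map (Maybe.map inject₁) s) nothing j)
          (Vecₚ.lookup-map j (Maybe.map inject₁) s)

  lookup-embed-fromℕ : lookup (embed s) (fromℕ N) ≡ nothing
  lookup-embed-fromℕ = lookup-∷ʳ-fromℕ (Vec.map (Maybe.map inject₁) s) nothing

  embed-[]≔ : ∀ j c → embed s [ inject₁ j ]≔ just (inject₁ c) ≡ embed (s [ j ]≔ just c)
  embed-[]≔ j c = trans (∷ʳ-[inject₁]≔ _ nothing j _)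
                        (cong (_∷ʳ nothing) (sym (Vecₚ.map-[]≔ (Maybe.map inject₁) s j)))

  isFreeAfter-embed : ∀ a k → isFreeAfter (embed s) (inject₁ a) (inject₁ k) ≡ isFreeAfter s a k
  isFreeAfter-embed a k rewrite Finₚ.toℕ-inject₁ a | Finₚ.toℕ-inject₁ k with lookup s k in occupant
  ... | nothing rewrite lookup-embed-inject₁ occupant = refl
  ... | just _  rewrite lookup-embed-inject₁ occupant = refl

  isFreeAfter-embed-fromℕ : ∀ a → T (isFreeAfter (embed s) (inject₁ a) (fromℕ N))
  isFreeAfter-embed-fromℕ a rewrite lookup-embed-fromℕ | Finₚ.toℕ-fromℕ N =
    Equivalence.from T-∧ (ℕₚ.<⇒<ᵇ (Finₚ.inject₁ℕ< a) , _)

  firstFreeAfter-embed : ∀ {a f} → firstFreeAfter s a ≡ f →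
                         firstFreeAfter (embed s) (inject₁ a) ≡ (Maybe.map inject₁ f <∣> just (fromℕ N))
  firstFreeAfter-embed {a} refl = begin
    head (filter free? (allFin (suc N)))
      ≡⟨ cong (head ∘ filter free?) (allFin-suc N) ⟩
    head (filter free? (List.map inject₁ (allFin N) ++ [ fromℕ N ]))
      ≡⟨ cong head (Listₚ.filter-++ free? (List.map inject₁ (allFin N)) [ fromℕ N ]) ⟩
    head (filter free? (List.map inject₁ (allFin N)) ++ filter free? [ fromℕ N ])
      ≡⟨ head-++ (filter free? (List.map inject₁ (allFin N))) _ ⟩
    (head (filter free? (List.map inject₁ (allFin N))) <∣> head (filter free? [ fromℕ N ]))
      ≡⟨ cong₂ _<∣>_ embedded-spots last-spot ⟩
    (Maybe.map inject₁ (firstFreeAfter s a) <∣> just (fromℕ N)) ∎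
    where
    open ≡-Reasoning
    free? : Decidable (T ∘ isFreeAfter (embed s) (inject₁ a))
    free? k = T? (isFreeAfter (embed s) (inject₁ a) k)
    embedded-spots : head (filter free? (List.map inject₁ (allFin N))) ≡ Maybe.map inject₁ (firstFreeAfter s a)
    embedded-spots = begin
      head (filter free? (List.map inject₁ (allFin N)))
        ≡⟨ cong head (filter-map free? inject₁ (allFin N)) ⟩
      head (List.map inject₁ (filter (free? ∘ inject₁) (allFin N)))
        ≡⟨ Listₚ.head-map (filter (free? ∘ inject₁) (allFin N)) ⟩
      Maybe.map inject₁ (head (filter (free? ∘ inject₁) (allFin N)))
        ≡⟨ cong (Maybe.map inject₁ ∘ head)
                (Listₚ.filter-≐ (free? ∘ inject₁) (T? ∘ isFreeAfter s a) same (allFin N)) ⟩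
      Maybe.map inject₁ (firstFreeAfter s a) ∎
      where
      same : T ∘ isFreeAfter (embed s) (inject₁ a) ∘ inject₁ ≐ T ∘ isFreeAfter s a
      same = (λ {k} → subst T (isFreeAfter-embed a k)) , (λ {k} → subst T (sym (isFreeAfter-embed a k)))
    last-spot : head (filter free? [ fromℕ N ]) ≡ just (fromℕ N)
    last-spot = cong head (Listₚ.filter-accept free? (isFreeAfter-embed-fromℕ a))

data Lifted {N : ℕ} : Maybe (State N) → Maybe (State (suc N)) → Set where
  lifted  : ∀ s → Lifted (just s) (just (embed s))
  blocked : ∀ {mb} → Blocked mb → Lifted nothing mb

mvpStep-lifted : ∀ {N} {m : Maybe (State N)} {mb} → Lifted m mb → ∀ i a →
                 Lifted (mvpStep m (i , a)) (mvpStep mb (inject₁ i , inject₁ a))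
mvpStep-lifted (blocked b) i a = blocked (mvpStep-blocked b _)
mvpStep-lifted {N} (lifted s) i a with lookup s a in occupant
... | nothing
  rewrite mvpStep-park {s = embed s} (inject₁ i) (lookup-embed-inject₁ s occupant) | embed-[]≔ s a i
  = lifted _
... | just j with firstFreeAfter s a in free
...   | just k
  rewrite mvpStep-bump {s = embed s} (inject₁ i) (lookup-embed-inject₁ s occupant) (firstFreeAfter-embed s free)
        | embed-[]≔ s a i | embed-[]≔ (s [ a ]≔ just i) k j
  = lifted _
...   | nothing
  rewrite mvpStep-bump {s = embed s} (inject₁ i) (lookup-embed-inject₁ s occupant) (firstFreeAfter-embed s free)
  = blocked (j , Vecₚ.lookup∘update (fromℕ N) (embed s [ inject₁ a ]≔ just (inject₁ i)) _)

foldl-lifted : ∀ {N} {m : Maybe (State N)} {mb} → Lifted m mb → ∀ qs →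
               Lifted (foldl mvpStep m qs) (foldl mvpStep mb (List.map (Prod.map inject₁ inject₁) qs))
foldl-lifted r []             = r
foldl-lifted r ((i , a) ∷ qs) = foldl-lifted (mvpStep-lifted r i a) qs

prefers-last⇒blocked : ∀ {N} (cs : List (Fin N)) (as : List (Fin (suc N))) (mb : Maybe (State (suc N))) →
                       length cs ≡ length as → fromℕ N ∈ as →
                       Blocked (foldl mvpStep mb (zip (List.map inject₁ cs) as))
prefers-last⇒blocked (c ∷ cs) (a ∷ as) mb len (here refl) =
  foldl-blocked (mvpStep-prefers-last mb c) (zip (List.map inject₁ cs) as)
prefers-last⇒blocked (c ∷ cs) (a ∷ as) mb len (there last∈as) =
  prefers-last⇒blocked cs as (mvpStep mb (inject₁ c , a)) (ℕₚ.suc-injective len) last∈as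

appendMax : ∀ {N k} → Vec (Fin N) k → Vec (Fin (suc N)) (suc k)
appendMax {N} xs = Vec.map inject₁ xs ∷ʳ fromℕ N

map-injective : ∀ {A B : Set} {f : A → B} {k} →
                Injective _≡_ _≡_ f → Injective _≡_ _≡_ (Vec.map {n = k} f)
map-injective f-inj {[]}     {[]}     eq = refl
map-injective f-inj {x ∷ xs} {y ∷ ys} eq =
  cong₂ _∷_ (f-inj (Vecₚ.∷-injectiveˡ eq)) (map-injective f-inj (Vecₚ.∷-injectiveʳ eq))

appendMax-injective : ∀ {N k} → Injective _≡_ _≡_ (appendMax {N} {k})
appendMax-injective {x = xs} {ys} eq =
  map-injective Finₚ.inject₁-injective (Vecₚ.∷ʳ-injectiveˡ (Vec.map inject₁ xs) (Vec.map inject₁ ys) eq)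

lookup-appendMax-inject₁ : ∀ {N k} (xs : Vec (Fin N) k) j →
                           lookup (appendMax xs) (inject₁ j) ≡ inject₁ (lookup xs j)
lookup-appendMax-inject₁ xs j =
  trans (lookup-∷ʳ-inject₁ (Vec.map inject₁ xs) _ j) (Vecₚ.lookup-map j inject₁ xs)

lastCar-lifted : ∀ {N} {m : Maybe (State N)} {mb} → Lifted m mb →
                 (mvpStep mb (fromℕ N , fromℕ N) >>= allJust) ≡ Maybe.map appendMax (m >>= allJust)
lastCar-lifted (blocked b) = cong (_>>= allJust) (mvpStep-blocked-last b _)
lastCar-lifted {N} (lifted s) = begin
  (mvpStep (just (embed s)) (fromℕ N , fromℕ N) >>= allJust)
    ≡⟨ cong (_>>= allJust) (mvpStep-park {s = embed s} (fromℕ N) (lookup-embed-fromℕ s)) ⟩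
  allJust (embed s [ fromℕ N ]≔ just (fromℕ N))
    ≡⟨ cong allJust (∷ʳ-[fromℕ]≔ (Vec.map (Maybe.map inject₁) s) nothing (just (fromℕ N))) ⟩
  allJust (Vec.map (Maybe.map inject₁) s ∷ʳ just (fromℕ N))
    ≡⟨ allJust-∷ʳ (Vec.map (Maybe.map inject₁) s) (fromℕ N) ⟩
  Maybe.map (_∷ʳ fromℕ N) (allJust (Vec.map (Maybe.map inject₁) s))
    ≡⟨ cong (Maybe.map (_∷ʳ fromℕ N)) (allJust-map inject₁ s) ⟩
  Maybe.map (_∷ʳ fromℕ N) (Maybe.map (Vec.map inject₁) (allJust s))
    ≡⟨ Maybeₚ.map-∘ (allJust s) ⟨
  Maybe.map appendMax (allJust s) ∎
  where open ≡-Reasoning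

embed-empty : ∀ N → replicate (suc N) nothing ≡ embed (replicate N nothing)
embed-empty N = trans (replicate-∷ʳ N nothing)
                      (cong (_∷ʳ nothing) (sym (Vecₚ.map-replicate (Maybe.map inject₁) nothing N)))

length-allFin-toList : ∀ {A : Set} {N} (xs : Vec A N) → length (allFin N) ≡ length (toList xs)
length-allFin-toList {N = N} xs = trans (Listₚ.length-tabulate id) (sym (Vecₚ.length-toList xs))

mvpRun : ∀ {N} → Vec (Fin N) N → Maybe (State N)
mvpRun {N} α = foldl mvpStep (just (replicate N nothing)) (zip (allFin N) (toList α))

parkAllButLast : ∀ {N} → Vec (Fin (suc N)) N → Maybe (State (suc N))
parkAllButLast {N} α =
  foldl mvpStep (just (embed (replicate N nothing))) (zip (List.map inject₁ (allFin N)) (toList α))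

mvpOutcome-∷ʳ : ∀ {N} (α : Vec (Fin (suc N)) N) p →
                mvpOutcome (α ∷ʳ p) ≡ (mvpStep (parkAllButLast α) (fromℕ N , p) >>= allJust)
mvpOutcome-∷ʳ {N} α p = begin
  (foldl mvpStep (just (replicate (suc N) nothing)) (zip (allFin (suc N)) (toList (α ∷ʳ p))) >>= allJust)
    ≡⟨ cong₂ (λ s qs → foldl mvpStep (just s) qs >>= allJust)
             (embed-empty N) (cong₂ zip (allFin-suc N) (Vecₚ.toList-∷ʳ p α)) ⟩
  (foldl mvpStep (just empty) (zip (cars ++ [ fromℕ N ]) (toList α ++ [ p ])) >>= allJust)
    ≡⟨ cong (λ qs → foldl mvpStep (just empty) qs >>= allJust) (zip-++ cars (toList α) same-length) ⟩
  (foldl mvpStep (just empty) (zip cars (toList α) ++ [ (fromℕ N , p) ]) >>= allJust)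
    ≡⟨ cong (_>>= allJust) (Listₚ.foldl-++ mvpStep (just empty) (zip cars (toList α)) _) ⟩
  (mvpStep (parkAllButLast α) (fromℕ N , p) >>= allJust) ∎
  where
  open ≡-Reasoning
  empty : State (suc N)
  empty = embed (replicate N nothing)
  cars : List (Fin (suc N))
  cars = List.map inject₁ (allFin N)
  same-length : length cars ≡ length (toList α)
  same-length = trans (Listₚ.length-map inject₁ (allFin N)) (length-allFin-toList α)

parkAllButLast-lifted : ∀ {N} (β : Vec (Fin N) N) → Lifted (mvpRun β) (parkAllButLast (Vec.map inject₁ β))
parkAllButLast-lifted {N} β =
  subst (Lifted (mvpRun β) ∘ foldl mvpStep (just (embed (replicate N nothing))))
        (sym lifted-arrivals)
        (foldl-lifted (lifted (replicate N nothing)) (zip (allFin N) (toList β)))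
  where
  lifted-arrivals : zip (List.map inject₁ (allFin N)) (toList (Vec.map inject₁ β)) ≡
                    List.map (Prod.map inject₁ inject₁) (zip (allFin N) (toList β))
  lifted-arrivals = trans (cong (zip (List.map inject₁ (allFin N))) (Vecₚ.toList-map inject₁ β))
                          (Listₚ.zip-map inject₁ inject₁ (allFin N) (toList β))

mvpOutcome-appendMax : ∀ {N} (β : Vec (Fin N) N) →
                       mvpOutcome (appendMax β) ≡ Maybe.map appendMax (mvpOutcome β)
mvpOutcome-appendMax {N} β =
  trans (mvpOutcome-∷ʳ (Vec.map inject₁ β) (fromℕ N)) (lastCar-lifted (parkAllButLast-lifted β))

map-inject₁-or-∋fromℕ : ∀ {N k} (xs : Vec (Fin (suc N)) k) →
                        (∃ λ ys → xs ≡ Vec.map inject₁ ys) ⊎ fromℕ N ∈ toList xs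
map-inject₁-or-∋fromℕ [] = inj₁ ([] , refl)
map-inject₁-or-∋fromℕ (x ∷ xs) with injectOrLast x | map-inject₁-or-∋fromℕ xs
... | last       | _                = inj₂ (here refl)
... | injected y | inj₁ (ys , refl) = inj₁ (y ∷ ys , refl)
... | injected y | inj₂ last∈xs     = inj₂ (there last∈xs)

mvpOutcome≡appendMax⇒ : ∀ {N} (α : Vec (Fin (suc N)) (suc N)) {v : Vec (Fin N) N} →
                        mvpOutcome α ≡ just (appendMax v) → ∃ λ β → α ≡ appendMax β
mvpOutcome≡appendMax⇒ {N} α {v} eq with Vec.initLast α
... | α₀ , p , refl with injectOrLast p | trans (sym (mvpOutcome-∷ʳ α₀ p)) eq
...   | injected a | eq′ = ⊥-elim (Finₚ.fromℕ≢inject₁ (begin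
  fromℕ N                          ≡⟨ mvpStep-allJust-lookup (parkAllButLast α₀) (fromℕ N) (inject₁ a) eq′ ⟨
  lookup (appendMax v) (inject₁ a) ≡⟨ lookup-appendMax-inject₁ v a ⟩
  inject₁ (lookup v a)             ∎))
  where open ≡-Reasoning
...   | last | eq′ with map-inject₁-or-∋fromℕ α₀
...     | inj₁ (β , refl) = β , refl
...     | inj₂ last∈α₀    = contradiction (trans (sym (lastCar-lifted (blocked prefix-blocked))) eq′) λ ()
  where
  prefix-blocked : Blocked (parkAllButLast α₀)
  prefix-blocked = prefers-last⇒blocked (allFin N) (toList α₀) _ (length-allFin-toList α₀) last∈α₀

fiberSize-appendMax : ∀ N (w : Vec (Fin N) N) → fiberSize (suc N) (appendMax w) ≡ fiberSize N w
fiberSize-appendMax N w =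
  length-filter-image (λ β → Maybeₚ.≡-dec (Vecₚ.≡-dec Finₚ._≟_) (mvpOutcome β) (just w))
                      (λ α → Maybeₚ.≡-dec (Vecₚ.≡-dec Finₚ._≟_) (mvpOutcome α) (just (appendMax w)))
                      appendMax appendMax-injective
                      (allVecs-unique N N) (allVecs-unique (suc N) (suc N)) (∈-allVecs N) (∈-allVecs (suc N))
                      forth back (λ α → mvpOutcome≡appendMax⇒ α)
  where
  forth : ∀ β → mvpOutcome β ≡ just w → mvpOutcome (appendMax β) ≡ just (appendMax w)
  forth β eq = trans (mvpOutcome-appendMax β) (cong (Maybe.map appendMax) eq)
  back : ∀ β → mvpOutcome (appendMax β) ≡ just (appendMax w) → mvpOutcome β ≡ just w
  back β eq = Maybeₚ.map-injective appendMax-injective (trans (sym (mvpOutcome-appendMax β)) eq)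

-- The function tabulated by extendOneLine is local to Defs; pairing the case
-- split with lookup∘tabulate makes Agda reduce it under the same scrutinee.
lookup-extendOneLine-< : ∀ {n m} (n≤m : n ≤ m) (π : Permutation′ n) (j : Fin m) (j<n : toℕ j < n) →
                         lookup (extendOneLine n≤m π) j ≡ inject≤ (π ⟨$⟩ʳ fromℕ< j<n) n≤m
lookup-extendOneLine-< {n} n≤m π j j<n
  with toℕ j <? n | (lookup (extendOneLine n≤m π) j ≡ _ ∋ Vecₚ.lookup∘tabulate _ j)
... | yes _   | eq = eq
... | no  j≮n | _  = contradiction j<n j≮n

lookup-extendOneLine-≮ : ∀ {n m} (n≤m : n ≤ m) (π : Permutation′ n) (j : Fin m) → ¬ toℕ j < n →
                         lookup (extendOneLine n≤m π) j ≡ j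
lookup-extendOneLine-≮ {n} n≤m π j j≮n
  with toℕ j <? n | (lookup (extendOneLine n≤m π) j ≡ _ ∋ Vecₚ.lookup∘tabulate _ j)
... | yes j<n | _  = contradiction j<n j≮n
... | no  _   | eq = eq

extendOneLine-refl : ∀ {n} (n≤n : n ≤ n) (π : Permutation′ n) → extendOneLine n≤n π ≡ oneLine π
extendOneLine-refl n≤n π = ≡-by-lookup λ j → begin
  lookup (extendOneLine n≤n π) j              ≡⟨ lookup-extendOneLine-< n≤n π j (Finₚ.toℕ<n j) ⟩
  inject≤ (π ⟨$⟩ʳ fromℕ< (Finₚ.toℕ<n j)) n≤n ≡⟨ Finₚ.toℕ-injective (Finₚ.toℕ-inject≤ _ n≤n) ⟩
  π ⟨$⟩ʳ fromℕ< (Finₚ.toℕ<n j)                ≡⟨ cong (π ⟨$⟩ʳ_) (Finₚ.fromℕ<-toℕ j (Finₚ.toℕ<n j)) ⟩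
  π ⟨$⟩ʳ j                                     ≡⟨ Vecₚ.lookup∘tabulate (π ⟨$⟩ʳ_) j ⟨
  lookup (oneLine π) j                         ∎
  where open ≡-Reasoning

extendOneLine-suc : ∀ {n k} (n≤k : n ≤ k) (n≤1+k : n ≤ suc k) (π : Permutation′ n) →
                    extendOneLine n≤1+k π ≡ appendMax (extendOneLine n≤k π)
extendOneLine-suc {n} {k} n≤k n≤1+k π = ≡-by-lookup entry
  where
  entry : ∀ j → lookup (extendOneLine n≤1+k π) j ≡ lookup (appendMax (extendOneLine n≤k π)) j
  entry j with injectOrLast j
  ... | last rewrite lookup-∷ʳ-fromℕ (Vec.map inject₁ (extendOneLine n≤k π)) (fromℕ k) =
    lookup-extendOneLine-≮ n≤1+k π (fromℕ k)
      (λ k<n → ℕₚ.<⇒≱ k<n (subst (n ≤_) (sym (Finₚ.toℕ-fromℕ k)) n≤k))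
  ... | injected i rewrite lookup-appendMax-inject₁ (extendOneLine n≤k π) i with toℕ i <? n
  ...   | no i≮n
    rewrite lookup-extendOneLine-≮ n≤k π i i≮n =
    lookup-extendOneLine-≮ n≤1+k π (inject₁ i) (i≮n ∘ subst (_< n) (Finₚ.toℕ-inject₁ i))
  ...   | yes i<n
    rewrite lookup-extendOneLine-< n≤k π i i<n
          | lookup-extendOneLine-< n≤1+k π (inject₁ i) (subst (_< n) (sym (Finₚ.toℕ-inject₁ i)) i<n) =
    Finₚ.toℕ-injective (begin
      toℕ (inject≤ (π ⟨$⟩ʳ fromℕ< _) n≤1+k) ≡⟨ Finₚ.toℕ-inject≤ _ n≤1+k ⟩
      toℕ (π ⟨$⟩ʳ fromℕ< _)
        ≡⟨ cong (λ i′ → toℕ (π ⟨$⟩ʳ i′)) (Finₚ.fromℕ<-cong _ _ (Finₚ.toℕ-inject₁ i) _ i<n) ⟩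
      toℕ (π ⟨$⟩ʳ fromℕ< i<n)              ≡⟨ Finₚ.toℕ-inject≤ _ n≤k ⟨
      toℕ (inject≤ (π ⟨$⟩ʳ fromℕ< i<n) n≤k) ≡⟨ Finₚ.toℕ-inject₁ _ ⟨
      toℕ (inject₁ (inject≤ (π ⟨$⟩ʳ fromℕ< i<n) n≤k)) ∎)
    where open ≡-Reasoning

fiberSize-extendOneLine : ∀ {n m} → n ≤′ m → (n≤m : n ≤ m) (π : Permutation′ n) →
                          fiberSize m (extendOneLine n≤m π) ≡ fiberSize n (oneLine π)
fiberSize-extendOneLine {n} ≤′-refl n≤n π = cong (fiberSize n) (extendOneLine-refl n≤n π)
fiberSize-extendOneLine {n} {suc k} (≤′-step n≤′k) n≤1+k π = begin
  fiberSize (suc k) (extendOneLine n≤1+k π)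
    ≡⟨ cong (fiberSize (suc k)) (extendOneLine-suc n≤k n≤1+k π) ⟩
  fiberSize (suc k) (appendMax (extendOneLine n≤k π))
    ≡⟨ fiberSize-appendMax k (extendOneLine n≤k π) ⟩
  fiberSize k (extendOneLine n≤k π)
    ≡⟨ fiberSize-extendOneLine n≤′k n≤k π ⟩
  fiberSize n (oneLine π) ∎
  where
  open ≡-Reasoning
  n≤k : n ≤ k
  n≤k = ℕₚ.≤′⇒≤ n≤′k

lemma4p22 : (n m : ℕ) (m>n : n < m) (π : Permutation′ n) →
    fiberSize m (extendOneLine (ℕₚ.<⇒≤ m>n) π) ≡ fiberSize n (oneLine π)
lemma4p22 n m m>n π = fiberSize-extendOneLine (ℕₚ.≤⇒≤′ (ℕₚ.<⇒≤ m>n)) (ℕₚ.<⇒≤ m>n) π
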